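{- For every positive integer $L$, $$\sum_{n\ge 0}a_2(L,n)q^n=\frac{1}{(q;q^2)_L}\left(q^2+q^3\frac{1-q^{2L-2}}{1-q^2}+q^6\frac{1-q^{4L-4}}{1-q^4}\right).$$
   Context: A partition of $n$ is a non-increasing finite sequence of positive integers summing to $n$ (the empty partition is the unique partition of $0$). Its Young diagram has $\lambda_i$ left-justified cells in row $i$; with $\lambda'_j$ the number of cells in column $j$, the hook length of cell $(i,j)$ is $h(i,j)=\lambda_i+\lambda'_j-i-j+1$. For a positive integer $L$, $a_2(L,n)$ is the total number of cells of hook length $2$, summed over all partitions of $n$ into odd parts with largest part at most $2L-1$. Here $(a;q)_L=\prod_{k=0}^{L-1}(1-aq^k)$, and the identity is one of formal power series in $q$. -}

module Defs where

open import Data.Nat as ℕ using (ℕ; zero; suc; _∸_; _≤ᵇ_; _≡ᵇ_; _⊓_)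
open import Data.Bool using (Bool; true; false; if_then_else_; _∧_; T)
open import Data.Integer as ℤ using (ℤ; +_)
open import Data.List using (List; []; _∷_; map; concatMap; filter; length; foldr; zip; upTo; head)
open import Data.Maybe using (fromMaybe)
open import Data.Product using (_×_; _,_)
open import Data.Nat.Properties using (_≤?_)
open import Relation.Nullary.Decidable using (T?)

-- ptnsF fuel n m : all non-increasing lists of positive integers with
-- sum n and every part ≤ m (fuel ≥ n suffices; we always use fuel = n).
ptnsF : ℕ → ℕ → ℕ → List (List ℕ)
ptnsF _ zero _ = [] ∷ []
ptnsF zero (suc _) _ = []
ptnsF (suc f) (suc n) m =
  concatMap (λ k → map (suc k ∷_) (ptnsF f (suc n ∸ suc k) (suc k)))
            (filter (λ k → suc k ≤? (suc n ⊓ m)) (upTo (suc n)))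

partitions : ℕ → List (List ℕ)
partitions n = ptnsF n n n

allB : (ℕ → Bool) → List ℕ → Bool
allB p [] = true
allB p (x ∷ xs) = p x ∧ allB p xs

isOdd : ℕ → Bool
isOdd n = ℕ._%_ n 2 ≡ᵇ 1

oddPartitions : ℕ → ℕ → List (List ℕ)
oddPartitions L n =
  filter (λ λs → T? (allB (λ p → isOdd p ∧ (p ≤ᵇ (2 ℕ.* L ∸ 1))) λs))
         (partitions n)

conj : List ℕ → ℕ → ℕ
conj λs j = length (filter (λ p → j ≤? p) λs)

-- Hook length of cell (i , j) (1-indexed, j ≤ λ_i, i ≤ λ'_j):
-- h(i,j) = λ_i + λ'_j - i - j + 1 = (λ_i - j) + (λ'_j - i) + 1.
hook : List ℕ → ℕ → ℕ → ℕ
hook λs i j = (λi ∸ j) ℕ.+ (conj λs j ∸ i) ℕ.+ 1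
  where
    nth : List ℕ → ℕ → ℕ
    nth [] _ = 0
    nth (x ∷ _) zero = x
    nth (_ ∷ xs) (suc k) = nth xs k
    λi = nth λs (i ∸ 1)

sumℕ : List ℕ → ℕ
sumℕ = foldr ℕ._+_ 0

cells : List ℕ → List (ℕ × ℕ)
cells λs = concatMap (λ { (i , p) → map (λ j → (i , suc j)) (upTo p) })
                     (zip (map suc (upTo (length λs))) λs)

hook2 : List ℕ → ℕ
hook2 λs = length (filter (λ { (i , j) → hook λs i j ℕ.≟ 2 }) (cells λs))

a2 : ℕ → ℕ → ℕ
a2 L n = sumℕ (map hook2 (oddPartitions L n))

Series : Set
Series = ℕ → ℤ

sumℤ : List ℤ → ℤ
sumℤ = foldr ℤ._+_ (+ 0)

_⊕_ : Series → Series → Series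
(f ⊕ g) n = f n ℤ.+ g n

_⊖_ : Series → Series → Series
(f ⊖ g) n = f n ℤ.- g n

_⊛_ : Series → Series → Series
(f ⊛ g) n = sumℤ (map (λ k → f k ℤ.* g (n ∸ k)) (upTo (suc n)))

infixl 6 _⊕_ _⊖_
infixl 7 _⊛_

one : Series
one zero = + 1
one (suc _) = + 0

qpow : ℕ → Series
qpow k n = if k ≡ᵇ n then + 1 else + 0

-- Multiplicative inverse of a series f with constant term 1:
-- c₀ = 1, c_{n} = - Σ_{k=1}^{n} f_k c_{n-k}.
-- invRev f n = [c_n , c_{n-1} , … , c_0].
invRev : Series → ℕ → List ℤ
invRev f zero = + 1 ∷ []
invRev f (suc n) = ℤ.- sumℤ (go 1 cs) ∷ cs
  where
    cs = invRev f n
    go : ℕ → List ℤ → List ℤ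
    go k [] = []
    go k (c ∷ rest) = f k ℤ.* c ∷ go (suc k) rest

inv : Series → Series
inv f n = fromMaybe (+ 0) (head (invRev f n))

-- (a;q)_L = ∏_{k<L} (1 - a q^k), here for a = q^a, q replaced by q^b:
-- (q^a ; q^b)_L = ∏_{k<L} (1 - q^{a + b k}).
qPoch : ℕ → ℕ → ℕ → Series
qPoch a b zero = one
qPoch a b (suc L) = qPoch a b L ⊛ (one ⊖ qpow (a ℕ.+ b ℕ.* L))

A2 : ℕ → Series
A2 L n = + a2 L n

RHS : ℕ → Series
RHS L = inv (qPoch 1 2 L) ⊛
  ( qpow 2
  ⊕ qpow 3 ⊛ ((one ⊖ qpow (2 ℕ.* L ∸ 2)) ⊛ inv (one ⊖ qpow 2))
  ⊕ qpow 6 ⊛ ((one ⊖ qpow (4 ℕ.* L ∸ 4)) ⊛ inv (one ⊖ qpow 4)))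

{-# OPTIONS --safe #-}
module Submission where

-- Let C m and H m be the generating functions of the partitions into allowed parts ≤ m,
-- counted plainly and weighted by the number of cells of hook length 2.  Splitting off the
-- largest part v = w + 1 gives C v = C w + q^v C v.  Under a first row of length v only the
-- last two cells of that row can have hook length 2: the last one iff exactly one other part
-- equals v, the one before iff no other part reaches v - 1.  These contribute q^v C w and
-- C (v - 2), and C (v - 2) = C w when v - 1 is not allowed.  Hence
-- H v (1 - q^v) = H w + q^v ([v ≥ 2] + q^v) C w, and with D m = ∏ (1 - q^v) over the allowed
-- v ≤ m, H m D m = Σ q^v ([v ≥ 2] + q^v).  For the odd parts up to 2L - 1, D m = (q; q²)_L
-- and the sum is the bracket of the theorem, a combination of two finite geometric series.

open import Defs
open import Data.Bool using (Bool)
open import Data.Nat using (ℕ; suc)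
open import Relation.Binary.PropositionalEquality using (_≡_; module ≡-Reasoning)

module Series where
  open import Data.Bool using (if_then_else_)
  open import Data.Integer using (ℤ; +_; -_; _+_; _*_; _-_)
  import Data.Integer.Properties as ℤ
  open import Data.Integer.Tactic.RingSolver using (solve-∀)
  open import Data.List using (List; []; _∷_; map; upTo; applyUpTo)
  open import Data.List.Properties using (map-upTo; map-applyUpTo; map-cong)
  open import Data.Nat as ℕ using (zero; suc; _∸_; _≤ᵇ_)
  open import Function using (_∘_)
  open import Relation.Binary.PropositionalEquality
    using (_≡_; _≗_; refl; sym; trans; cong; cong₂; _→-setoid_; module ≡-Reasoning)
  import Relation.Binary.Reasoning.Setoid

  module ≗-Reasoning = Relation.Binary.Reasoning.Setoid (ℕ →-setoid ℤ)

  0ₛ : Series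
  0ₛ _ = + 0

  tail : Series → Series
  tail f n = f (suc n)

  scale : ℤ → Series → Series
  scale c f n = c * f n

  ⊕-cong : ∀ {f f′ g g′} → f ≗ f′ → g ≗ g′ → f ⊕ g ≗ f′ ⊕ g′
  ⊕-cong f≗f′ g≗g′ n = cong₂ _+_ (f≗f′ n) (g≗g′ n)

  ⊕-congˡ : ∀ f {g g′} → g ≗ g′ → f ⊕ g ≗ f ⊕ g′
  ⊕-congˡ f = ⊕-cong {f} (λ _ → refl)

  ⊕-congʳ : ∀ g {f f′} → f ≗ f′ → f ⊕ g ≗ f′ ⊕ g
  ⊕-congʳ g f≗f′ = ⊕-cong {g = g} f≗f′ (λ _ → refl)

  ⊕-identityˡ : ∀ f → 0ₛ ⊕ f ≗ f
  ⊕-identityˡ f n = ℤ.+-identityˡ (f n)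

  ⊕-identityʳ : ∀ f → f ⊕ 0ₛ ≗ f
  ⊕-identityʳ f n = ℤ.+-identityʳ (f n)

  ⊛-cong : ∀ {f f′ g g′} → f ≗ f′ → g ≗ g′ → f ⊛ g ≗ f′ ⊛ g′
  ⊛-cong f≗f′ g≗g′ n =
    cong sumℤ (map-cong (λ k → cong₂ _*_ (f≗f′ k) (g≗g′ (n ∸ k))) (upTo (suc n)))

  ⊛-congˡ : ∀ f {g g′} → g ≗ g′ → f ⊛ g ≗ f ⊛ g′
  ⊛-congˡ f = ⊛-cong {f} (λ _ → refl)

  ⊛-congʳ : ∀ g {f f′} → f ≗ f′ → f ⊛ g ≗ f′ ⊛ g
  ⊛-congʳ g f≗f′ = ⊛-cong {g = g} f≗f′ (λ _ → refl)

  sumℤ-map-+ : ∀ {A : Set} (F G : A → ℤ) xs →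
               sumℤ (map (λ x → F x + G x) xs) ≡ sumℤ (map F xs) + sumℤ (map G xs)
  sumℤ-map-+ F G []       = refl
  sumℤ-map-+ F G (x ∷ xs) =
    trans (cong (_+_ (F x + G x)) (sumℤ-map-+ F G xs)) (interchange (F x) (G x) _ _)
    where
    interchange : ∀ a b c d → a + b + (c + d) ≡ a + c + (b + d)
    interchange = solve-∀

  sumℤ-map-neg : ∀ {A : Set} (F : A → ℤ) xs → sumℤ (map (λ x → - F x) xs) ≡ - sumℤ (map F xs)
  sumℤ-map-neg F []       = refl
  sumℤ-map-neg F (x ∷ xs) =
    trans (cong (_+_ (- F x)) (sumℤ-map-neg F xs)) (sym (ℤ.neg-distrib-+ (F x) _))

  sumℤ-map-* : ∀ {A : Set} c (F : A → ℤ) xs → sumℤ (map (λ x → c * F x) xs) ≡ c * sumℤ (map F xs)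
  sumℤ-map-* c F []       = sym (ℤ.*-zeroʳ c)
  sumℤ-map-* c F (x ∷ xs) =
    trans (cong (_+_ (c * F x)) (sumℤ-map-* c F xs)) (sym (ℤ.*-distribˡ-+ c (F x) _))

  ⊛-distribˡ : ∀ h f g → h ⊛ (f ⊕ g) ≗ h ⊛ f ⊕ h ⊛ g
  ⊛-distribˡ h f g n = trans
    (cong sumℤ (map-cong (λ k → ℤ.*-distribˡ-+ (h k) (f (n ∸ k)) (g (n ∸ k))) (upTo (suc n))))
    (sumℤ-map-+ (λ k → h k * f (n ∸ k)) (λ k → h k * g (n ∸ k)) (upTo (suc n)))

  ⊛-distribˡ-⊖ : ∀ h f g → h ⊛ (f ⊖ g) ≗ h ⊛ f ⊖ h ⊛ g
  ⊛-distribˡ-⊖ h f g n = trans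
    (cong sumℤ (map-cong (λ k → distrib (h k) (f (n ∸ k)) (g (n ∸ k))) (upTo (suc n))))
    (trans (sumℤ-map-+ (λ k → h k * f (n ∸ k)) (λ k → - (h k * g (n ∸ k))) (upTo (suc n)))
           (cong (_+_ ((h ⊛ f) n)) (sumℤ-map-neg (λ k → h k * g (n ∸ k)) (upTo (suc n)))))
    where
    distrib : ∀ a b c → a * (b - c) ≡ a * b + - (a * c)
    distrib = solve-∀

  ⊛-scaleˡ : ∀ c f g → scale c f ⊛ g ≗ scale c (f ⊛ g)
  ⊛-scaleˡ c f g n = trans
    (cong sumℤ (map-cong (λ k → ℤ.*-assoc c (f k) (g (n ∸ k))) (upTo (suc n))))
    (sumℤ-map-* c (λ k → f k * g (n ∸ k)) (upTo (suc n)))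

  ⊛-coeff-zero : ∀ f g → (f ⊛ g) 0 ≡ f 0 * g 0
  ⊛-coeff-zero f g = ℤ.+-identityʳ _

  ⊛-coeff-suc : ∀ f g n → (f ⊛ g) (suc n) ≡ f 0 * g (suc n) + (tail f ⊛ g) n
  ⊛-coeff-suc f g n = cong (λ xs → f 0 * g (suc n) + sumℤ xs)
    (trans (map-applyUpTo suc (λ k → f k * g (suc n ∸ k)) (suc n))
           (sym (map-upTo (λ k → f (suc k) * g (n ∸ k)) (suc n))))

  ⊛-zeroˡ : ∀ g → 0ₛ ⊛ g ≗ 0ₛ
  ⊛-zeroˡ g zero    = trans (⊛-coeff-zero 0ₛ g) (ℤ.*-zeroˡ (g 0))
  ⊛-zeroˡ g (suc n) = trans (⊛-coeff-suc 0ₛ g n) (cong₂ _+_ (ℤ.*-zeroˡ (g (suc n))) (⊛-zeroˡ g n))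

  ⊛-identityˡ : ∀ g → one ⊛ g ≗ g
  ⊛-identityˡ g zero    = trans (⊛-coeff-zero one g) (ℤ.*-identityˡ (g 0))
  ⊛-identityˡ g (suc n) = trans (⊛-coeff-suc one g n)
    (trans (cong₂ _+_ (ℤ.*-identityˡ (g (suc n))) (⊛-zeroˡ g n)) (ℤ.+-identityʳ (g (suc n))))

  ⊛-comm : ∀ f g → f ⊛ g ≗ g ⊛ f
  ⊛-comm f g zero = trans (⊛-coeff-zero f g) (trans (ℤ.*-comm (f 0) (g 0)) (sym (⊛-coeff-zero g f)))
  ⊛-comm f g (suc zero) = begin
    (f ⊛ g) 1                     ≡⟨ ⊛-coeff-suc f g 0 ⟩
    f 0 * g 1 + (tail f ⊛ g) 0    ≡⟨ cong (_+_ (f 0 * g 1)) (⊛-coeff-zero (tail f) g) ⟩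
    f 0 * g 1 + f 1 * g 0         ≡⟨ swap (f 0) (g 1) (f 1) (g 0) ⟩
    g 0 * f 1 + g 1 * f 0         ≡⟨ cong (_+_ (g 0 * f 1)) (⊛-coeff-zero (tail g) f) ⟨
    g 0 * f 1 + (tail g ⊛ f) 0    ≡⟨ ⊛-coeff-suc g f 0 ⟨
    (g ⊛ f) 1                     ∎
    where
    open ≡-Reasoning
    swap : ∀ a b c d → a * b + c * d ≡ d * c + b * a
    swap = solve-∀
  ⊛-comm f g (suc (suc n)) = begin
    (f ⊛ g) (2+ n)                              ≡⟨ ⊛-coeff-suc f g (suc n) ⟩
    a + (tail f ⊛ g) (suc n)                    ≡⟨ cong (_+_ a) (⊛-comm (tail f) g (suc n)) ⟩
    a + (g ⊛ tail f) (suc n)                    ≡⟨ cong (_+_ a) (⊛-coeff-suc g (tail f) n) ⟩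
    a + (b + (tail g ⊛ tail f) n)               ≡⟨ cong (λ x → a + (b + x)) (⊛-comm (tail g) (tail f) n) ⟩
    a + (b + (tail f ⊛ tail g) n)               ≡⟨ exchange a b _ ⟩
    b + (a + (tail f ⊛ tail g) n)               ≡⟨ cong (_+_ b) (⊛-coeff-suc f (tail g) n) ⟨
    b + (f ⊛ tail g) (suc n)                    ≡⟨ cong (_+_ b) (⊛-comm f (tail g) (suc n)) ⟩
    b + (tail g ⊛ f) (suc n)                    ≡⟨ ⊛-coeff-suc g f (suc n) ⟨
    (g ⊛ f) (2+ n)                              ∎
    where
    open ≡-Reasoning
    2+ : ℕ → ℕ
    2+ m = suc (suc m)
    a = f 0 * g (2+ n)
    b = g 0 * f (2+ n)
    exchange : ∀ a b c → a + (b + c) ≡ b + (a + c)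
    exchange = solve-∀

  ⊛-identityʳ : ∀ f → f ⊛ one ≗ f
  ⊛-identityʳ f n = trans (⊛-comm f one n) (⊛-identityˡ f n)

  ⊛-zeroʳ : ∀ f → f ⊛ 0ₛ ≗ 0ₛ
  ⊛-zeroʳ f n = trans (⊛-comm f 0ₛ n) (⊛-zeroˡ f n)

  ⊛-distribʳ : ∀ h f g → (f ⊕ g) ⊛ h ≗ f ⊛ h ⊕ g ⊛ h
  ⊛-distribʳ h f g n = begin
    ((f ⊕ g) ⊛ h) n        ≡⟨ ⊛-comm (f ⊕ g) h n ⟩
    (h ⊛ (f ⊕ g)) n        ≡⟨ ⊛-distribˡ h f g n ⟩
    (h ⊛ f) n + (h ⊛ g) n  ≡⟨ cong₂ _+_ (⊛-comm h f n) (⊛-comm h g n) ⟩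
    (f ⊛ h) n + (g ⊛ h) n  ∎
    where open ≡-Reasoning

  ⊛-assoc : ∀ f g h → (f ⊛ g) ⊛ h ≗ f ⊛ (g ⊛ h)
  ⊛-assoc f g h zero = begin
    ((f ⊛ g) ⊛ h) 0        ≡⟨ ⊛-coeff-zero (f ⊛ g) h ⟩
    (f ⊛ g) 0 * h 0        ≡⟨ cong (_* h 0) (⊛-coeff-zero f g) ⟩
    f 0 * g 0 * h 0        ≡⟨ ℤ.*-assoc (f 0) (g 0) (h 0) ⟩
    f 0 * (g 0 * h 0)      ≡⟨ cong (f 0 *_) (⊛-coeff-zero g h) ⟨
    f 0 * (g ⊛ h) 0        ≡⟨ ⊛-coeff-zero f (g ⊛ h) ⟨
    (f ⊛ (g ⊛ h)) 0        ∎
    where open ≡-Reasoning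
  ⊛-assoc f g h (suc n) = begin
    ((f ⊛ g) ⊛ h) (suc n)
      ≡⟨ ⊛-coeff-suc (f ⊛ g) h n ⟩
    (f ⊛ g) 0 * h (suc n) + (tail (f ⊛ g) ⊛ h) n
      ≡⟨ cong₂ _+_ (cong (_* h (suc n)) (⊛-coeff-zero f g)) (⊛-congʳ h (⊛-coeff-suc f g) n) ⟩
    a + ((scale (f 0) (tail g) ⊕ tail f ⊛ g) ⊛ h) n
      ≡⟨ cong (_+_ a) (⊛-distribʳ h (scale (f 0) (tail g)) (tail f ⊛ g) n) ⟩
    a + ((scale (f 0) (tail g) ⊛ h) n + ((tail f ⊛ g) ⊛ h) n)
      ≡⟨ cong (_+_ a) (cong₂ _+_ (⊛-scaleˡ (f 0) (tail g) h n) (⊛-assoc (tail f) g h n)) ⟩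
    a + (f 0 * (tail g ⊛ h) n + (tail f ⊛ (g ⊛ h)) n)
      ≡⟨ factor (f 0) (g 0) (h (suc n)) _ _ ⟩
    f 0 * (g 0 * h (suc n) + (tail g ⊛ h) n) + (tail f ⊛ (g ⊛ h)) n
      ≡⟨ cong (λ x → f 0 * x + (tail f ⊛ (g ⊛ h)) n) (⊛-coeff-suc g h n) ⟨
    f 0 * (g ⊛ h) (suc n) + (tail f ⊛ (g ⊛ h)) n
      ≡⟨ ⊛-coeff-suc f (g ⊛ h) n ⟨
    (f ⊛ (g ⊛ h)) (suc n)
      ∎
    where
    open ≡-Reasoning
    a = f 0 * g 0 * h (suc n)
    factor : ∀ a b c x y → a * b * c + (a * x + y) ≡ a * (b * c + x) + y
    factor = solve-∀

  qpow-cong : ∀ {a b} → a ≡ b → qpow a ≗ qpow b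
  qpow-cong refl _ = refl

  qpow-zero : qpow 0 ≗ one
  qpow-zero zero    = refl
  qpow-zero (suc n) = refl

  one-⊖-qpow-zero : one ⊖ qpow 0 ≗ 0ₛ
  one-⊖-qpow-zero zero    = refl
  one-⊖-qpow-zero (suc n) = refl

  qpow-suc-⊛-coeff-zero : ∀ a g → (qpow (suc a) ⊛ g) 0 ≡ + 0
  qpow-suc-⊛-coeff-zero a g = trans (⊛-coeff-zero (qpow (suc a)) g) (ℤ.*-zeroˡ (g 0))

  qpow-suc-⊛-coeff-suc : ∀ a g n → (qpow (suc a) ⊛ g) (suc n) ≡ (qpow a ⊛ g) n
  qpow-suc-⊛-coeff-suc a g n = trans (⊛-coeff-suc (qpow (suc a)) g n) (ℤ.+-identityˡ _)

  qpow-⊛-coeff : ∀ a g n → (qpow a ⊛ g) n ≡ (if a ≤ᵇ n then g (n ∸ a) else + 0)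
  qpow-⊛-coeff zero    g n       = trans (⊛-congʳ g qpow-zero n) (⊛-identityˡ g n)
  qpow-⊛-coeff (suc a) g zero    = qpow-suc-⊛-coeff-zero a g
  qpow-⊛-coeff (suc a) g (suc n) =
    trans (qpow-suc-⊛-coeff-suc a g n) (trans (qpow-⊛-coeff a g n) (shift a))
    where
    shift : ∀ a → (if a ≤ᵇ n then g (n ∸ a) else + 0) ≡ (if suc a ≤ᵇ suc n then g (suc n ∸ suc a) else + 0)
    shift zero    = refl
    shift (suc a) = refl

  qpow-+ : ∀ a b → qpow a ⊛ qpow b ≗ qpow (a ℕ.+ b)
  qpow-+ zero    b n       = trans (⊛-congʳ (qpow b) qpow-zero n) (⊛-identityˡ (qpow b) n)
  qpow-+ (suc a) b zero    = qpow-suc-⊛-coeff-zero a (qpow b)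
  qpow-+ (suc a) b (suc n) = trans (qpow-suc-⊛-coeff-suc a (qpow b) n) (qpow-+ a b n)

  weighted : Series → ℕ → List ℤ → List ℤ
  weighted f k []       = []
  weighted f k (c ∷ cs) = f k * c ∷ weighted f (suc k) cs

  weighted-unique : ∀ {f} {go : ℕ → List ℤ → List ℤ} →
    (∀ k → go k [] ≡ []) → (∀ k c cs → go k (c ∷ cs) ≡ f k * c ∷ go (suc k) cs) →
    ∀ k cs → go k cs ≡ weighted f k cs
  weighted-unique go[] go∷ k [] = go[] k
  weighted-unique {f} {go} go[] go∷ k (c ∷ cs) =
    trans (go∷ k c cs) (cong (f k * c ∷_) (weighted-unique {go = go} go[] go∷ (suc k) cs))

  -- `invRev` weights the coefficients with a function local to `Defs`.  Once the arguments
  -- it is applied to are abstracted, unification identifies it with `weighted`.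
  inv-suc : ∀ f n → inv f (suc n) ≡ - sumℤ (weighted f 1 (invRev f n))
  inv-suc f n with weighted-unique {f} (λ _ → refl) (λ _ _ _ → refl) | sumℤ | 1 | invRev f n
  ... | go≡weighted | Σ | k | cs = cong (λ xs → - Σ xs) (go≡weighted k cs)

  weighted-suc : ∀ f k cs → weighted f (suc k) cs ≡ weighted (tail f) k cs
  weighted-suc f k []       = refl
  weighted-suc f k (c ∷ cs) = cong (f (suc k) * c ∷_) (weighted-suc f (suc k) cs)

  weighted-applyUpTo : ∀ f h m → weighted f 0 (applyUpTo h m) ≡ applyUpTo (λ i → f i * h i) m
  weighted-applyUpTo f h zero    = refl
  weighted-applyUpTo f h (suc m) = cong (f 0 * h 0 ∷_)
    (trans (weighted-suc f 0 (applyUpTo (h ∘ suc) m)) (weighted-applyUpTo (tail f) (h ∘ suc) m))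

  invRev-applyUpTo : ∀ f n → invRev f n ≡ applyUpTo (λ i → inv f (n ∸ i)) (suc n)
  invRev-applyUpTo f zero    = refl
  invRev-applyUpTo f (suc n) = cong (inv f (suc n) ∷_) (invRev-applyUpTo f n)

  inv-suc-⊛ : ∀ f n → inv f (suc n) ≡ - (tail f ⊛ inv f) n
  inv-suc-⊛ f n = trans (inv-suc f n) (cong (λ xs → - sumℤ xs) (begin
    weighted f 1 (invRev f n)                    ≡⟨ cong (weighted f 1) (invRev-applyUpTo f n) ⟩
    weighted f 1 (applyUpTo c (suc n))           ≡⟨ weighted-suc f 0 (applyUpTo c (suc n)) ⟩
    weighted (tail f) 0 (applyUpTo c (suc n))    ≡⟨ weighted-applyUpTo (tail f) c (suc n) ⟩
    applyUpTo (λ i → f (suc i) * c i) (suc n)    ≡⟨ map-upTo (λ i → f (suc i) * c i) (suc n) ⟨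
    map (λ i → f (suc i) * c i) (upTo (suc n))   ∎))
    where
    open ≡-Reasoning
    c = λ i → inv f (n ∸ i)

  ⊛-inverseʳ : ∀ f → f 0 ≡ + 1 → f ⊛ inv f ≗ one
  ⊛-inverseʳ f f₀≡1 zero    = trans (⊛-coeff-zero f (inv f)) (cong (_* + 1) f₀≡1)
  ⊛-inverseʳ f f₀≡1 (suc n) = begin
    (f ⊛ inv f) (suc n)                  ≡⟨ ⊛-coeff-suc f (inv f) n ⟩
    f 0 * inv f (suc n) + t              ≡⟨ cong₂ (λ a b → a * b + t) f₀≡1 (inv-suc-⊛ f n) ⟩
    + 1 * - t + t                        ≡⟨ cancel t ⟩
    + 0                                  ∎
    where
    open ≡-Reasoning
    t = (tail f ⊛ inv f) n
    cancel : ∀ x → + 1 * - x + x ≡ + 0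
    cancel = solve-∀

  ⊛-inverse-cancel : ∀ f g → f 0 ≡ + 1 → inv f ⊛ (g ⊛ f) ≗ g
  ⊛-inverse-cancel f g f₀≡1 = begin
    inv f ⊛ (g ⊛ f)  ≈⟨ ⊛-congˡ (inv f) (⊛-comm g f) ⟩
    inv f ⊛ (f ⊛ g)  ≈⟨ ⊛-assoc (inv f) f g ⟨
    (inv f ⊛ f) ⊛ g  ≈⟨ ⊛-congʳ g (λ n → trans (⊛-comm (inv f) f n) (⊛-inverseʳ f f₀≡1 n)) ⟩
    one ⊛ g          ≈⟨ ⊛-identityˡ g ⟩
    g                ∎
    where open ≗-Reasoning

  ⊛-one-minus : ∀ x y z q → x ≗ y ⊕ q ⊛ (x ⊕ z) → x ⊛ (one ⊖ q) ≗ y ⊕ q ⊛ z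
  ⊛-one-minus x y z q x≗y+q[x+z] n = begin
    (x ⊛ (one ⊖ q)) n
      ≡⟨ ⊛-distribˡ-⊖ x one q n ⟩
    (x ⊛ one) n - (x ⊛ q) n
      ≡⟨ cong₂ _-_ (trans (⊛-identityʳ x n) (x≗y+q[x+z] n)) (⊛-comm x q n) ⟩
    y n + (q ⊛ (x ⊕ z)) n - (q ⊛ x) n
      ≡⟨ cong (λ a → y n + a - (q ⊛ x) n) (⊛-distribˡ q x z n) ⟩
    y n + ((q ⊛ x) n + (q ⊛ z) n) - (q ⊛ x) n
      ≡⟨ cancel (y n) ((q ⊛ x) n) ((q ⊛ z) n) ⟩
    y n + (q ⊛ z) n
      ∎
    where
    open ≡-Reasoning
    cancel : ∀ a b c → a + (b + c) - b ≡ a + c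
    cancel = solve-∀

  one-⊖-qpow-+ : ∀ a d → one ⊖ qpow (a ℕ.+ d) ≗ (one ⊖ qpow a) ⊕ qpow a ⊛ (one ⊖ qpow d)
  one-⊖-qpow-+ a d n = sym (begin
    (one n - qpow a n) + (qpow a ⊛ (one ⊖ qpow d)) n
      ≡⟨ cong (_+_ (one n - qpow a n)) (⊛-distribˡ-⊖ (qpow a) one (qpow d) n) ⟩
    (one n - qpow a n) + ((qpow a ⊛ one) n - (qpow a ⊛ qpow d) n)
      ≡⟨ cong (_+_ (one n - qpow a n)) (cong₂ _-_ (⊛-identityʳ (qpow a) n) (qpow-+ a d n)) ⟩
    (one n - qpow a n) + (qpow a n - qpow (a ℕ.+ d) n)
      ≡⟨ ℤ.+-minus-telescope (one n) (qpow a n) (qpow (a ℕ.+ d) n) ⟩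
    one n - qpow (a ℕ.+ d) n
      ∎)
    where open ≡-Reasoning

  geometric-step : ∀ a d → (one ⊖ qpow (a ℕ.+ suc d)) ⊛ inv (one ⊖ qpow (suc d))
                         ≗ (one ⊖ qpow a) ⊛ inv (one ⊖ qpow (suc d)) ⊕ qpow a
  geometric-step a d = begin
    (one ⊖ qpow (a ℕ.+ suc d)) ⊛ I          ≈⟨ ⊛-congʳ I (one-⊖-qpow-+ a (suc d)) ⟩
    ((one ⊖ qpow a) ⊕ qpow a ⊛ F) ⊛ I        ≈⟨ ⊛-distribʳ I (one ⊖ qpow a) (qpow a ⊛ F) ⟩
    A ⊕ (qpow a ⊛ F) ⊛ I                     ≈⟨ ⊕-congˡ A (⊛-assoc (qpow a) F I) ⟩
    A ⊕ qpow a ⊛ (F ⊛ I)                     ≈⟨ ⊕-congˡ A (⊛-congˡ (qpow a) (⊛-inverseʳ F refl)) ⟩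
    A ⊕ qpow a ⊛ one                         ≈⟨ ⊕-congˡ A (⊛-identityʳ (qpow a)) ⟩
    A ⊕ qpow a                               ∎
    where
    open ≗-Reasoning
    F = one ⊖ qpow (suc d)
    I = inv F
    A = (one ⊖ qpow a) ⊛ I

module Partitions where
  open import Data.Bool using (true; false; if_then_else_)
  open import Data.List using (List; []; _∷_; [_]; _++_; map; filter; concatMap; upTo)
  open import Data.List.Properties
    using (upTo-∷ʳ; filter-++; filter-accept; filter-reject; ++-identityʳ; concatMap-++; concatMap-cong; map-++; map-∘)
  open import Data.List.Relation.Unary.All as All using (All; []; _∷_)
  open import Data.List.Relation.Unary.All.Properties using (all-filter; concat⁺; map⁺)
  open import Data.Nat using (zero; suc; _+_; _∸_; _≤_; _⊓_; _≤ᵇ_; _≤?_; s≤s; s≤s⁻¹)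
  open import Data.Nat.ListAction.Properties using (sum-++)
  open import Data.Nat.Tactic.RingSolver using (solve-∀)
  open import Data.Nat.Properties
    using ( ≤-trans; ≤-refl; <⇒≤; m∸n≤m; n≤1+n; +-identityʳ; m⊓n≤m; m⊓n≤n; m≤n⇒m⊓n≡m; m≥n⇒m⊓n≡n
          ; ≰⇒>; ≤ᵇ-reflects-≤)
  open import Function using (_∘_)
  open import Relation.Nullary using (Dec; yes; no)
  open import Relation.Nullary.Reflects using (ofʸ; ofⁿ)
  open import Relation.Binary.PropositionalEquality
    using (_≡_; refl; sym; trans; cong; cong₂; module ≡-Reasoning)

  ptns : ℕ → ℕ → List (List ℕ)
  ptns n m = ptnsF n n m

  withLargest : ℕ → ℕ → ℕ → List (List ℕ)
  withLargest f n k = map (suc k ∷_) (ptnsF f (n ∸ k) (suc k))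

  filter-upTo : ∀ N c → filter (λ k → suc k ≤? c) (upTo N) ≡ upTo (N ⊓ c)
  filter-upTo zero    c = refl
  filter-upTo (suc N) c = begin
    filter P? (upTo (suc N))               ≡⟨ cong (filter P?) (upTo-∷ʳ N) ⟨
    filter P? (upTo N ++ [ N ])            ≡⟨ filter-++ P? (upTo N) [ N ] ⟩
    filter P? (upTo N) ++ filter P? [ N ]  ≡⟨ cong (_++ filter P? [ N ]) (filter-upTo N c) ⟩
    upTo (N ⊓ c) ++ filter P? [ N ]        ≡⟨ last (suc N ≤? c) ⟩
    upTo (suc N ⊓ c)                       ∎
    where
    open ≡-Reasoning
    P? = λ k → suc k ≤? c
    last : Dec (suc N ≤ c) → upTo (N ⊓ c) ++ filter P? [ N ] ≡ upTo (suc N ⊓ c)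
    last (yes N<c) rewrite filter-accept P? {xs = []} N<c
                         | m≤n⇒m⊓n≡m (<⇒≤ N<c) | m≤n⇒m⊓n≡m N<c = upTo-∷ʳ N
    last (no N≮c)  rewrite filter-reject P? {xs = []} N≮c
                         | m≥n⇒m⊓n≡n (s≤s⁻¹ (≰⇒> N≮c))
                         | m≥n⇒m⊓n≡n (≤-trans (s≤s⁻¹ (≰⇒> N≮c)) (n≤1+n N)) = ++-identityʳ (upTo c)

  ptnsF-suc : ∀ f n m → ptnsF (suc f) (suc n) m ≡ concatMap (withLargest f n) (upTo (suc n ⊓ m))
  ptnsF-suc f n m = cong (concatMap (withLargest f n))
    (trans (filter-upTo (suc n) (suc n ⊓ m)) (cong upTo (m≥n⇒m⊓n≡n (m⊓n≤m (suc n) m))))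

  ptnsF-fuel : ∀ {f f′} n m → n ≤ f → n ≤ f′ → ptnsF f n m ≡ ptnsF f′ n m
  ptnsF-fuel zero    m _ _ = refl
  ptnsF-fuel {suc f} {suc f′} (suc n) m (s≤s n≤f) (s≤s n≤f′) =
    concatMap-cong (λ k → cong (map (suc k ∷_)) (ptnsF-fuel (n ∸ k) (suc k) (≤-trans (m∸n≤m n k) n≤f)
                                                                            (≤-trans (m∸n≤m n k) n≤f′)))
                   (filter (λ k → suc k ≤? (suc n ⊓ m)) (upTo (suc n)))

  ptns-below : ∀ n m → m ≤ suc n → ptns (suc n) m ≡ concatMap (withLargest n n) (upTo m)
  ptns-below n m m≤n = trans (ptnsF-suc n n m) (cong (concatMap (withLargest n n) ∘ upTo) (m≥n⇒m⊓n≡n m≤n))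

  ptns-above : ∀ n m → suc n ≤ m → ptns (suc n) m ≡ concatMap (withLargest n n) (upTo (suc n))
  ptns-above n m n<m = trans (ptnsF-suc n n m) (cong (concatMap (withLargest n n) ∘ upTo) (m≤n⇒m⊓n≡m n<m))

  ptns-bound : ∀ n m → n ≤ m → ptns n m ≡ ptns n n
  ptns-bound zero    m _   = refl
  ptns-bound (suc n) m n<m = trans (ptns-above n m n<m) (sym (ptns-above n (suc n) ≤-refl))

  concatMap-upTo-suc : ∀ {A : Set} (F : ℕ → List A) w → concatMap F (upTo (suc w)) ≡ concatMap F (upTo w) ++ F w
  concatMap-upTo-suc F w = trans (cong (concatMap F) (sym (upTo-∷ʳ w)))
    (trans (concatMap-++ F (upTo w) [ w ]) (cong (concatMap F (upTo w) ++_) (++-identityʳ (F w))))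

  ptns-suc : ∀ n w →
    ptns n (suc w) ≡ ptns n w ++ (if suc w ≤ᵇ n then map (suc w ∷_) (ptns (n ∸ suc w) (suc w)) else [])
  ptns-suc zero    w = refl
  ptns-suc (suc n) w with suc w ≤ᵇ suc n | ≤ᵇ-reflects-≤ (suc w) (suc n)
  ... | true  | ofʸ w<n@(s≤s w≤n) = begin
    ptns (suc n) (suc w)
      ≡⟨ ptns-below n (suc w) w<n ⟩
    concatMap L (upTo (suc w))
      ≡⟨ concatMap-upTo-suc L w ⟩
    concatMap L (upTo w) ++ L w
      ≡⟨ cong₂ _++_ (sym (ptns-below n w (≤-trans w≤n (n≤1+n n))))
                    (cong (map (suc w ∷_)) (ptnsF-fuel (n ∸ w) (suc w) (m∸n≤m n w) ≤-refl)) ⟩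
    ptns (suc n) w ++ map (suc w ∷_) (ptns (n ∸ w) (suc w))
      ∎
    where
    open ≡-Reasoning
    L = withLargest n n
  ... | false | ofⁿ w≮n = trans (ptns-above n (suc w) (≤-trans n<w (n≤1+n w)))
                         (trans (sym (ptns-above n w n<w)) (sym (++-identityʳ _)))
    where n<w = s≤s⁻¹ (≰⇒> w≮n)

  ptnsF-bounded : ∀ f n m → All (All (_≤ m)) (ptnsF f n m)
  ptnsF-bounded _       zero    m = [] ∷ []
  ptnsF-bounded zero    (suc n) m = []
  ptnsF-bounded (suc f) (suc n) m =
    concat⁺ (map⁺ (All.map largest (all-filter (λ k → suc k ≤? (suc n ⊓ m)) (upTo (suc n)))))
    where
    largest : ∀ {k} → suc k ≤ suc n ⊓ m → All (All (_≤ m)) (withLargest f n k)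
    largest {k} k<n⊓m = map⁺ (All.map (λ μ≤k → k<m ∷ All.map (λ p≤k → ≤-trans p≤k k<m) μ≤k)
                                      (ptnsF-bounded f (n ∸ k) (suc k)))
      where k<m = ≤-trans k<n⊓m (m⊓n≤n (suc n) m)

  ptns-bounded : ∀ n m → All (All (_≤ m)) (ptns n m)
  ptns-bounded n = ptnsF-bounded n n

  sumℕ-map-+ : ∀ {A : Set} (F G : A → ℕ) xs →
               sumℕ (map (λ x → F x + G x) xs) ≡ sumℕ (map F xs) + sumℕ (map G xs)
  sumℕ-map-+ F G []       = refl
  sumℕ-map-+ F G (x ∷ xs) =
    trans (cong (_+_ (F x + G x)) (sumℕ-map-+ F G xs)) (interchange (F x) (G x) _ _)
    where
    interchange : ∀ a b c d → a + b + (c + d) ≡ a + c + (b + d)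
    interchange = solve-∀

  sumℕ-map-zero : ∀ {A : Set} (F : A → ℕ) xs → (∀ x → F x ≡ 0) → sumℕ (map F xs) ≡ 0
  sumℕ-map-zero F []       _   = refl
  sumℕ-map-zero F (x ∷ xs) F≡0 = cong₂ _+_ (F≡0 x) (sumℕ-map-zero F xs F≡0)

  sum-ptns-suc : ∀ (F : List ℕ → ℕ) n w →
    sumℕ (map F (ptns n (suc w)))
      ≡ sumℕ (map F (ptns n w))
        + (if suc w ≤ᵇ n then sumℕ (map (F ∘ (suc w ∷_)) (ptns (n ∸ suc w) (suc w))) else 0)
  sum-ptns-suc F n w rewrite ptns-suc n w with suc w ≤ᵇ n
  ... | true  = trans (cong sumℕ (map-++ F (ptns n w) top))
                      (trans (sum-++ (map F (ptns n w)) (map F top))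
                             (cong (sumℕ (map F (ptns n w)) +_)
                                   (cong sumℕ (sym (map-∘ (ptns (n ∸ suc w) (suc w)))))))
    where top = map (suc w ∷_) (ptns (n ∸ suc w) (suc w))
  ... | false = trans (cong (sumℕ ∘ map F) (++-identityʳ (ptns n w))) (sym (+-identityʳ _))

module Hooks where
  open import Data.Bool using (true; false; if_then_else_)
  open import Data.List using (List; []; _∷_; [_]; _++_; map; filter; concatMap; upTo; zip; length)
  open import Data.List.Properties using (map-∘; map-++; map-upTo; map-cong-local; filter-accept; filter-none; upTo-∷ʳ)
  open import Data.List.Relation.Unary.All as All using (All; []; _∷_)
  open import Data.List.Relation.Unary.All.Properties using (++⁺; map⁺; applyUpTo⁺₁)
  open import Data.Nat using (zero; suc; _+_; _∸_; _≤_; _<_; _≡ᵇ_; _≤?_; z≤n; s≤s)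
  open import Data.Nat.ListAction.Properties using (sum-++)
  open import Data.Nat.Properties using (≤-trans; ≤⇒≯; +-comm; +-identityʳ; n∸n≡0; m+n∸n≡m)
  open import Data.Product using (_×_; _,_; proj₁; proj₂; uncurry)
  open import Function using (_∘_; id)
  open import Relation.Nullary using (does)
  open import Relation.Unary using (Decidable)
  open import Relation.Binary.PropositionalEquality
    using (_≡_; refl; sym; trans; cong; cong₂; module ≡-Reasoning)

  𝟙 : Bool → ℕ
  𝟙 b = if b then 1 else 0

  count : ∀ {A : Set} → (A → Bool) → List A → ℕ
  count p xs = sumℕ (map (𝟙 ∘ p) xs)

  length-filter≡count : ∀ {A : Set} {P : A → Set} (P? : Decidable P) xs →
                        length (filter P? xs) ≡ count (does ∘ P?) xs
  length-filter≡count P? []       = refl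
  length-filter≡count P? (x ∷ xs) with does (P? x)
  ... | true  = cong suc (length-filter≡count P? xs)
  ... | false = length-filter≡count P? xs

  count-++ : ∀ {A : Set} (p : A → Bool) xs ys → count p (xs ++ ys) ≡ count p xs + count p ys
  count-++ p xs ys = trans (cong sumℕ (map-++ (𝟙 ∘ p) xs ys)) (sum-++ (map (𝟙 ∘ p) xs) _)

  count-map : ∀ {A B : Set} (p : B → Bool) (f : A → B) xs → count p (map f xs) ≡ count (p ∘ f) xs
  count-map p f xs = cong sumℕ (sym (map-∘ xs))

  count-cong-All : ∀ {A : Set} {P : A → Set} (p q : A → Bool) {xs} →
                   (∀ {x} → P x → p x ≡ q x) → All P xs → count p xs ≡ count q xs
  count-cong-All p q p≡q Pxs = cong sumℕ (map-cong-local (All.map (cong 𝟙 ∘ p≡q) Pxs))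

  count-none : ∀ {A : Set} {P : A → Set} (p : A → Bool) {xs} →
               (∀ {x} → P x → p x ≡ false) → All P xs → count p xs ≡ 0
  count-none p {[]}     _       []         = refl
  count-none p {x ∷ xs} p≡false (Px ∷ Pxs) =
    trans (cong (λ b → 𝟙 b + count p xs) (p≡false Px)) (count-none p p≡false Pxs)

  count-upTo-suc : ∀ (p : ℕ → Bool) n → count p (upTo (suc n)) ≡ count p (upTo n) + 𝟙 (p n)
  count-upTo-suc p n = trans (cong (count p) (sym (upTo-∷ʳ n)))
    (trans (count-++ p (upTo n) [ n ]) (cong (count p (upTo n) +_) (+-identityʳ (𝟙 (p n)))))

  conj-cons : ∀ {v j} μ → j ≤ v → conj (v ∷ μ) j ≡ suc (conj μ j)
  conj-cons {j = j} μ j≤v = cong length (filter-accept (j ≤?_) {xs = μ} j≤v)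

  conj-bounded : ∀ {j μ} → All (_≤ j) μ → conj μ (suc j) ≡ 0
  conj-bounded μ≤j = cong length (filter-none (suc _ ≤?_) (All.map ≤⇒≯ μ≤j))

  lookup-agree : {nth nth′ : List ℕ → ℕ → ℕ} →
    (∀ k → nth [] k ≡ 0) → (∀ x xs → nth (x ∷ xs) 0 ≡ x) →
    (∀ x xs k → nth (x ∷ xs) (suc k) ≡ nth xs k) →
    (∀ k → nth′ [] k ≡ 0) → (∀ x xs → nth′ (x ∷ xs) 0 ≡ x) →
    (∀ x xs k → nth′ (x ∷ xs) (suc k) ≡ nth′ xs k) →
    ∀ xs k → nth xs k ≡ nth′ xs k
  lookup-agree n[] _ _ n′[] _ _ [] k = trans (n[] k) (sym (n′[] k))
  lookup-agree _ n0 _ _ n′0 _ (x ∷ xs) zero = trans (n0 x xs) (sym (n′0 x xs))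
  lookup-agree {nth} {nth′} n[] n0 ns n′[] n′0 n′s (x ∷ xs) (suc k) =
    trans (ns x xs k) (trans (lookup-agree {nth} {nth′} n[] n0 ns n′[] n′0 n′s xs k) (sym (n′s x xs k)))

  -- `hook` reads row lengths through a lookup function local to `Defs`, one copy per call;
  -- abstracting `μ` and `i` lets unification name both copies in `lookup-agree`.
  hook-cons : ∀ {v j} μ i → j ≤ v → hook (v ∷ μ) (suc (suc i)) j ≡ hook μ (suc i) j
  hook-cons {v} {j} μ i j≤v
    with lookup-agree (λ _ → refl) (λ _ _ → refl) (λ _ _ _ → refl)
                      (λ _ → refl) (λ _ _ → refl) (λ _ _ _ → refl)
       | μ | i
  ... | agree | ν | k = cong₂ (λ a c → (a ∸ j) + (c ∸ suc (suc k)) + 1) (agree ν k) (conj-cons ν j≤v)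

  rowCells : ℕ → ℕ → List (ℕ × ℕ)
  rowCells i p = map (λ j → i , suc j) (upTo p)

  nextRow : ℕ × ℕ → ℕ × ℕ
  nextRow (i , j) = suc i , j

  cells-relabel : ∀ is λs → concatMap (uncurry rowCells) (zip (map suc is) λs)
                          ≡ map nextRow (concatMap (uncurry rowCells) (zip is λs))
  cells-relabel []       λs       = refl
  cells-relabel (i ∷ is) []       = refl
  cells-relabel (i ∷ is) (p ∷ λs) =
    trans (cong₂ _++_ (map-∘ (upTo p)) (cells-relabel is λs)) (sym (map-++ nextRow (rowCells i p) _))

  cells-cons : ∀ v μ → cells (v ∷ μ) ≡ rowCells 1 v ++ map nextRow (cells μ)
  cells-cons v μ = cong (rowCells 1 v ++_) (trans
    (cong (λ is → concatMap (uncurry rowCells) (zip (map suc is) μ)) (sym (map-upTo suc (length μ))))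
    (cells-relabel (map suc (upTo (length μ))) μ))

  cells-bounded : ∀ {m} μ → All (_≤ m) μ → All (λ c → 1 ≤ proj₁ c × proj₂ c ≤ m) (cells μ)
  cells-bounded []      []          = []
  cells-bounded (p ∷ μ) (p≤m ∷ μ≤m) rewrite cells-cons p μ =
    ++⁺ (map⁺ (applyUpTo⁺₁ id p (λ j<p → s≤s z≤n , ≤-trans j<p p≤m)))
        (map⁺ (All.map (λ (_ , j≤m) → s≤s z≤n , j≤m) (cells-bounded μ μ≤m)))

  hookIs2 : List ℕ → ℕ × ℕ → Bool
  hookIs2 λs (i , j) = hook λs i j ≡ᵇ 2

  hook2-count : ∀ λs → hook2 λs ≡ count (hookIs2 λs) (cells λs)
  hook2-count λs = length-filter≡count _ (cells λs)

  firstRowHook2 : ℕ → List ℕ → ℕ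
  firstRowHook2 v μ = count (λ j → hook (v ∷ μ) 1 (suc j) ≡ᵇ 2) (upTo v)

  hook2-cons : ∀ v μ → All (_≤ v) μ → hook2 (v ∷ μ) ≡ firstRowHook2 v μ + hook2 μ
  hook2-cons v μ μ≤v = begin
    hook2 (v ∷ μ)
      ≡⟨ hook2-count (v ∷ μ) ⟩
    count P (cells (v ∷ μ))
      ≡⟨ cong (count P) (cells-cons v μ) ⟩
    count P (rowCells 1 v ++ map nextRow (cells μ))
      ≡⟨ count-++ P (rowCells 1 v) _ ⟩
    count P (rowCells 1 v) + count P (map nextRow (cells μ))
      ≡⟨ cong₂ _+_ (count-map P _ (upTo v)) (count-map P nextRow (cells μ)) ⟩
    firstRowHook2 v μ + count (P ∘ nextRow) (cells μ)
      ≡⟨ cong (firstRowHook2 v μ +_) lower-rows ⟩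
    firstRowHook2 v μ + count (hookIs2 μ) (cells μ)
      ≡⟨ cong (firstRowHook2 v μ +_) (hook2-count μ) ⟨
    firstRowHook2 v μ + hook2 μ
      ∎
    where
    open ≡-Reasoning
    P = hookIs2 (v ∷ μ)
    lower-rows : count (P ∘ nextRow) (cells μ) ≡ count (hookIs2 μ) (cells μ)
    lower-rows = count-cong-All (P ∘ nextRow) (hookIs2 μ)
      (λ { {suc i , j} (_ , j≤v) → cong (_≡ᵇ 2) (hook-cons μ i j≤v) }) (cells-bounded μ μ≤v)

  cornerHook : ℕ → List ℕ → ℕ
  cornerHook zero    μ = 0
  cornerHook (suc w) μ = 𝟙 (conj μ (suc w) ≡ᵇ 0)

  -- Cell (1 , suc j) has arm w ∸ j and leg conj μ (suc j), so only the last two can have hook 2.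
  firstRowHook2-suc : ∀ w μ → firstRowHook2 (suc w) μ ≡ cornerHook w μ + 𝟙 (conj μ (suc w) ≡ᵇ 1)
  firstRowHook2-suc w μ = begin
    firstRowHook2 (suc w) μ
      ≡⟨ count-cong-All _ (arm2 w) (cong (_≡ᵇ 2) ∘ first-row _) (applyUpTo⁺₁ id (suc w) id) ⟩
    count (arm2 w) (upTo (suc w))           ≡⟨ count-upTo-suc (arm2 w) w ⟩
    count (arm2 w) (upTo w) + 𝟙 (arm2 w w)  ≡⟨ cong₂ (λ c b → c + 𝟙 b) (before-last w) (last (a w)) ⟩
    cornerHook w μ + 𝟙 (a w ≡ᵇ 1)           ∎
    where
    open ≡-Reasoning
    a : ℕ → ℕ
    a j = conj μ (suc j)
    arm2 : ℕ → ℕ → Bool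
    arm2 w j = (w ∸ j) + a j + 1 ≡ᵇ 2
    first-row : ∀ j → j < suc w → hook (suc w ∷ μ) 1 (suc j) ≡ (w ∸ j) + a j + 1
    first-row j j<v = cong (λ c → (w ∸ j) + (c ∸ 1) + 1) (conj-cons μ j<v)
    last : ∀ c → ((w ∸ w) + c + 1 ≡ᵇ 2) ≡ (c ≡ᵇ 1)
    last c rewrite n∸n≡0 w | +-comm c 1 = refl
    arm≥2 : ∀ {u j} → j < u → suc u ∸ j ≡ 2 + (u ∸ suc j)
    arm≥2 {suc u} {zero}  _         = refl
    arm≥2 {suc u} {suc j} (s≤s j<u) = arm≥2 j<u
    long-arm : ∀ {u j} → j < u → arm2 (suc u) j ≡ false
    long-arm {u} {j} j<u rewrite arm≥2 j<u | +-comm ((u ∸ suc j) + a j) 1 = refl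
    before-last : ∀ u → count (arm2 u) (upTo u) ≡ cornerHook u μ
    before-last zero    = refl
    before-last (suc u) = begin
      count (arm2 (suc u)) (upTo (suc u))                 ≡⟨ count-upTo-suc (arm2 (suc u)) u ⟩
      count (arm2 (suc u)) (upTo u) + 𝟙 (arm2 (suc u) u)
        ≡⟨ cong₂ (λ c b → c + 𝟙 b) (count-none _ long-arm (applyUpTo⁺₁ id u id)) (corner-arm (a u)) ⟩
      cornerHook (suc u) μ                                ∎
      where
      corner-arm : ∀ c → ((suc u ∸ u) + c + 1 ≡ᵇ 2) ≡ (c ≡ᵇ 0)
      corner-arm c rewrite m+n∸n≡m 1 u | +-comm c 1 = refl

module RestrictedPartitions (allowed : ℕ → Bool) where
  open Series
  open Partitions
  open Hooks
  open import Data.Bool using (true; false; if_then_else_; _∧_)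
  open import Data.Bool.Properties using (if-float)
  open import Data.Integer as ℤ using (+_)
  open import Data.Integer.Properties using (pos-+)
  open import Data.List using (List; []; _∷_; map; filter)
  open import Data.List.Properties using (map-cong; map-cong-local)
  open import Data.List.Relation.Unary.All as All using (All)
  open import Data.Nat using (zero; suc; _+_; _∸_; _≤_; _<_; _≤ᵇ_; _≡ᵇ_; z≤n; s≤s)
  open import Data.Nat.Properties using (+-comm; +-identityʳ; ≤-refl; m≤n+m)
  open import Function using (_∘_)
  open import Relation.Nullary.Decidable using (T?)
  open import Relation.Binary.PropositionalEquality
    using (_≡_; _≗_; refl; sym; trans; cong; cong₂; module ≡-Reasoning)

  good : List ℕ → Bool
  good = allB allowed

  restrict : (List ℕ → ℕ) → List ℕ → ℕ
  restrict G μ = if good μ then G μ else 0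

  GF : (List ℕ → ℕ) → ℕ → Series
  GF G m n = + sumℕ (map (restrict G) (ptns n m))

  restrict-zero : ∀ G μ → G μ ≡ 0 → restrict G μ ≡ 0
  restrict-zero G μ Gμ≡0 with good μ
  ... | true  = Gμ≡0
  ... | false = refl

  restrict-+ : ∀ G G′ μ → restrict (λ ν → G ν + G′ ν) μ ≡ restrict G μ + restrict G′ μ
  restrict-+ G G′ μ with good μ
  ... | true  = refl
  ... | false = refl

  GF-cong-bounded : ∀ {G G′} m → (∀ {μ} → All (_≤ m) μ → G μ ≡ G′ μ) → GF G m ≗ GF G′ m
  GF-cong-bounded m G≡G′ n = cong (+_ ∘ sumℕ) (map-cong-local
    (All.map (λ {μ} μ≤m → cong (λ x → if good μ then x else 0) (G≡G′ μ≤m)) (ptns-bounded n m)))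

  GF-+ : ∀ G G′ m → GF (λ μ → G μ + G′ μ) m ≗ GF G m ⊕ GF G′ m
  GF-+ G G′ m n = trans (cong (+_ ∘ sumℕ) (map-cong (restrict-+ G G′) (ptns n m)))
    (trans (cong +_ (sumℕ-map-+ (restrict G) (restrict G′) (ptns n m)))
           (pos-+ (sumℕ (map (restrict G) (ptns n m))) _))

  GF-zero : ∀ G m → (∀ μ → G μ ≡ 0) → GF G m ≗ 0ₛ
  GF-zero G m G≡0 n = cong +_ (sumℕ-map-zero (restrict G) (ptns n m) (λ μ → restrict-zero G μ (G≡0 μ)))

  restrict-cons-allowed : ∀ G {v} μ → allowed v ≡ true → restrict G (v ∷ μ) ≡ restrict (G ∘ (v ∷_)) μ
  restrict-cons-allowed G {v} μ = cong (λ b → if b ∧ good μ then G (v ∷ μ) else 0)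

  restrict-cons-forbidden : ∀ G {v} μ → allowed v ≡ false → restrict G (v ∷ μ) ≡ 0
  restrict-cons-forbidden G {v} μ = cong (λ b → if b ∧ good μ then G (v ∷ μ) else 0)

  GF-step-allowed : ∀ G w → allowed (suc w) ≡ true →
                    GF G (suc w) ≗ GF G w ⊕ qpow (suc w) ⊛ GF (G ∘ (suc w ∷_)) (suc w)
  GF-step-allowed G w allowed-v n = begin
    GF G (suc w) n
      ≡⟨ cong +_ (sum-ptns-suc (restrict G) n w) ⟩
    + (S + (if v≤n then T else 0))
      ≡⟨ pos-+ S _ ⟩
    GF G w n ℤ.+ + (if v≤n then T else 0)
      ≡⟨ cong (ℤ._+_ (GF G w n)) (if-float +_ v≤n) ⟩
    GF G w n ℤ.+ (if v≤n then + T else + 0)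
      ≡⟨ cong (λ t → GF G w n ℤ.+ (if v≤n then + t else + 0)) top ⟩
    GF G w n ℤ.+ (if v≤n then GF G′ (suc w) (n ∸ suc w) else + 0)
      ≡⟨ cong (ℤ._+_ (GF G w n)) (qpow-⊛-coeff (suc w) (GF G′ (suc w)) n) ⟨
    (GF G w ⊕ qpow (suc w) ⊛ GF G′ (suc w)) n
      ∎
    where
    open ≡-Reasoning
    v≤n = suc w ≤ᵇ n
    G′ = G ∘ (suc w ∷_)
    S = sumℕ (map (restrict G) (ptns n w))
    T = sumℕ (map (restrict G ∘ (suc w ∷_)) (ptns (n ∸ suc w) (suc w)))
    top : T ≡ sumℕ (map (restrict G′) (ptns (n ∸ suc w) (suc w)))
    top = cong sumℕ (map-cong (λ μ → restrict-cons-allowed G μ allowed-v) (ptns (n ∸ suc w) (suc w)))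

  GF-step-forbidden : ∀ G w → allowed (suc w) ≡ false → GF G (suc w) ≗ GF G w
  GF-step-forbidden G w forbidden-v n = cong +_ (trans (sum-ptns-suc (restrict G) n w)
    (trans (cong (_+_ (sumℕ (map (restrict G) (ptns n w)))) (top (suc w ≤ᵇ n))) (+-identityʳ _)))
    where
    T = sumℕ (map (restrict G ∘ (suc w ∷_)) (ptns (n ∸ suc w) (suc w)))
    top : ∀ b → (if b then T else 0) ≡ 0
    top false = refl
    top true  = sumℕ-map-zero _ (ptns (n ∸ suc w) (suc w)) (λ μ → restrict-cons-forbidden G μ forbidden-v)

  GF-vanishing-top : ∀ G w → (∀ ν → G (suc w ∷ ν) ≡ 0) → GF G (suc w) ≗ GF G w
  GF-vanishing-top G w top≡0 with allowed (suc w) in allowed-v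
  ... | false = GF-step-forbidden G w allowed-v
  ... | true  = begin
    GF G (suc w)                                 ≈⟨ GF-step-allowed G w allowed-v ⟩
    GF G w ⊕ q ⊛ GF (G ∘ (suc w ∷_)) (suc w)     ≈⟨ ⊕-congˡ (GF G w) (⊛-congˡ q (GF-zero _ (suc w) top≡0)) ⟩
    GF G w ⊕ q ⊛ 0ₛ                              ≈⟨ ⊕-congˡ (GF G w) (⊛-zeroʳ q) ⟩
    GF G w ⊕ 0ₛ                                  ≈⟨ ⊕-identityʳ (GF G w) ⟩
    GF G w                                       ∎
    where
    open ≗-Reasoning
    q = qpow (suc w)

  GF-above : ∀ G m → (∀ {v} → m < v → allowed v ≡ false) → ∀ d → GF G (d + m) ≗ GF G m
  GF-above G m forbidden zero    n = refl
  GF-above G m forbidden (suc d) n =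
    trans (GF-step-forbidden G (d + m) (forbidden (s≤s (m≤n+m m d))) n) (GF-above G m forbidden d n)

  GF-bound : ∀ G {n m} → n ≤ m → GF G m n ≡ GF G n n
  GF-bound G {n} {m} n≤m = cong (+_ ∘ sumℕ ∘ map (restrict G)) (ptns-bound n m n≤m)

  sumℕ-filter : ∀ {A : Set} (p : A → Bool) (G : A → ℕ) xs →
                sumℕ (map G (filter (λ x → T? (p x)) xs)) ≡ sumℕ (map (λ x → if p x then G x else 0) xs)
  sumℕ-filter p G []       = refl
  sumℕ-filter p G (x ∷ xs) with p x
  ... | true  = cong (_+_ (G x)) (sumℕ-filter p G xs)
  ... | false = sumℕ-filter p G xs

  GF-diagonal : ∀ G n → + sumℕ (map G (filter (λ μ → T? (good μ)) (partitions n))) ≡ GF G n n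
  GF-diagonal G n = cong +_ (sumℕ-filter good G (ptns n n))

  C : ℕ → Series
  C = GF (λ _ → 1)

  H : ℕ → Series
  H = GF hook2

  C-zero : C 0 ≗ one
  C-zero zero    = refl
  C-zero (suc n) = cong (+_ ∘ sumℕ ∘ map (restrict (λ _ → 1))) (ptns-below n 0 z≤n)

  H-zero : H 0 ≗ 0ₛ
  H-zero zero    = refl
  H-zero (suc n) = cong (+_ ∘ sumℕ ∘ map (restrict hook2)) (ptns-below n 0 z≤n)

  GF-below : ∀ j d → GF (λ μ → 𝟙 (conj μ (suc j) ≡ᵇ 0)) (d + j) ≗ C j
  GF-below j zero      = GF-cong-bounded j (λ μ≤j → cong (λ c → 𝟙 (c ≡ᵇ 0)) (conj-bounded μ≤j))
  GF-below j (suc d) n = trans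
    (GF-vanishing-top _ (d + j) (λ ν → cong (λ c → 𝟙 (c ≡ᵇ 0)) (conj-cons ν (s≤s (m≤n+m j d)))) n)
    (GF-below j d n)

  GF-single : ∀ w → allowed (suc w) ≡ true →
              GF (λ μ → 𝟙 (conj μ (suc w) ≡ᵇ 1)) (suc w) ≗ qpow (suc w) ⊛ C w
  GF-single w allowed-v = begin
    GF single (suc w)                                              ≈⟨ GF-step-allowed single w allowed-v ⟩
    GF single w ⊕ q ⊛ GF (single ∘ (suc w ∷_)) (suc w)
      ≈⟨ ⊕-cong (GF-cong-bounded w (λ μ≤w → cong (λ c → 𝟙 (c ≡ᵇ 1)) (conj-bounded μ≤w)))
                (⊛-congˡ q (GF-cong-bounded (suc w)
                  (λ {ν} _ → cong (λ c → 𝟙 (c ≡ᵇ 1)) (conj-cons ν ≤-refl)))) ⟩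
    GF (λ _ → 0) w ⊕ q ⊛ GF (λ ν → 𝟙 (conj ν (suc w) ≡ᵇ 0)) (1 + w)
      ≈⟨ ⊕-cong (GF-zero (λ _ → 0) w (λ _ → refl)) (⊛-congˡ q (GF-below w 1)) ⟩
    0ₛ ⊕ q ⊛ C w                                                   ≈⟨ ⊕-identityˡ (q ⊛ C w) ⟩
    q ⊛ C w                                                        ∎
    where
    open ≗-Reasoning
    q = qpow (suc w)
    single = λ μ → 𝟙 (conj μ (suc w) ≡ᵇ 1)

  cornerGF : ℕ → Series
  cornerGF zero    = 0ₛ
  cornerGF (suc w) = C w

  GF-corner : ∀ w → GF (cornerHook w) (suc w) ≗ cornerGF w
  GF-corner zero    = GF-zero (cornerHook 0) 1 (λ _ → refl)
  GF-corner (suc w) = GF-below w 2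

  C-step-allowed : ∀ w → allowed (suc w) ≡ true → C (suc w) ≗ C w ⊕ qpow (suc w) ⊛ C (suc w)
  C-step-allowed = GF-step-allowed (λ _ → 1)

  H-step-allowed : ∀ w → allowed (suc w) ≡ true →
                   H (suc w) ≗ H w ⊕ qpow (suc w) ⊛ (H (suc w) ⊕ (cornerGF w ⊕ qpow (suc w) ⊛ C w))
  H-step-allowed w allowed-v = begin
    H (suc w)                                    ≈⟨ GF-step-allowed hook2 w allowed-v ⟩
    H w ⊕ q ⊛ GF (hook2 ∘ (suc w ∷_)) (suc w)    ≈⟨ ⊕-congˡ (H w) (⊛-congˡ q largest) ⟩
    H w ⊕ q ⊛ (H (suc w) ⊕ (cornerGF w ⊕ q ⊛ C w)) ∎
    where
    open ≗-Reasoning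
    q = qpow (suc w)
    single = λ μ → 𝟙 (conj μ (suc w) ≡ᵇ 1)
    split : ∀ {μ} → All (_≤ suc w) μ → hook2 (suc w ∷ μ) ≡ hook2 μ + (cornerHook w μ + single μ)
    split {μ} μ≤v = trans (hook2-cons (suc w) μ μ≤v)
                          (trans (cong (_+ hook2 μ) (firstRowHook2-suc w μ)) (+-comm _ (hook2 μ)))
    largest : GF (hook2 ∘ (suc w ∷_)) (suc w) ≗ H (suc w) ⊕ (cornerGF w ⊕ q ⊛ C w)
    largest = begin
      GF (hook2 ∘ (suc w ∷_)) (suc w)
        ≈⟨ GF-cong-bounded (suc w) split ⟩
      GF (λ μ → hook2 μ + (cornerHook w μ + single μ)) (suc w)
        ≈⟨ GF-+ hook2 _ (suc w) ⟩
      H (suc w) ⊕ GF (λ μ → cornerHook w μ + single μ) (suc w)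
        ≈⟨ ⊕-congˡ (H (suc w)) (GF-+ (cornerHook w) single (suc w)) ⟩
      H (suc w) ⊕ (GF (cornerHook w) (suc w) ⊕ GF single (suc w))
        ≈⟨ ⊕-congˡ (H (suc w)) (⊕-cong (GF-corner w) (GF-single w allowed-v)) ⟩
      H (suc w) ⊕ (cornerGF w ⊕ q ⊛ C w)
        ∎

  D : ℕ → Series
  D zero    = one
  D (suc w) = if allowed (suc w) then D w ⊛ (one ⊖ qpow (suc w)) else D w

  D-allowed : ∀ w → allowed (suc w) ≡ true → D (suc w) ≡ D w ⊛ (one ⊖ qpow (suc w))
  D-allowed w = cong (λ b → if b then D w ⊛ (one ⊖ qpow (suc w)) else D w)

  D-forbidden : ∀ w → allowed (suc w) ≡ false → D (suc w) ≡ D w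
  D-forbidden w = cong (λ b → if b then D w ⊛ (one ⊖ qpow (suc w)) else D w)

  C-one-minus : ∀ w → allowed (suc w) ≡ true → C (suc w) ⊛ (one ⊖ qpow (suc w)) ≗ C w
  C-one-minus w allowed-v = begin
    C (suc w) ⊛ (one ⊖ q)   ≈⟨ ⊛-one-minus (C (suc w)) (C w) 0ₛ q step ⟩
    C w ⊕ q ⊛ 0ₛ            ≈⟨ ⊕-congˡ (C w) (⊛-zeroʳ q) ⟩
    C w ⊕ 0ₛ                ≈⟨ ⊕-identityʳ (C w) ⟩
    C w                     ∎
    where
    open ≗-Reasoning
    q = qpow (suc w)
    step : C (suc w) ≗ C w ⊕ q ⊛ (C (suc w) ⊕ 0ₛ)
    step = begin
      C (suc w)                      ≈⟨ C-step-allowed w allowed-v ⟩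
      C w ⊕ q ⊛ C (suc w)            ≈⟨ ⊕-congˡ (C w) (⊛-congˡ q (⊕-identityʳ (C (suc w)))) ⟨
      C w ⊕ q ⊛ (C (suc w) ⊕ 0ₛ)     ∎

  C⊛D : ∀ m → C m ⊛ D m ≗ one
  C⊛D zero n = trans (⊛-congʳ one C-zero n) (⊛-identityˡ one n)
  C⊛D (suc w) with allowed (suc w) in allowed-v
  ... | false = λ n → trans (⊛-congʳ (D w) (GF-step-forbidden (λ _ → 1) w allowed-v) n) (C⊛D w n)
  ... | true  = begin
    C (suc w) ⊛ (D w ⊛ F)    ≈⟨ ⊛-congˡ (C (suc w)) (⊛-comm (D w) F) ⟩
    C (suc w) ⊛ (F ⊛ D w)    ≈⟨ ⊛-assoc (C (suc w)) F (D w) ⟨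
    (C (suc w) ⊛ F) ⊛ D w    ≈⟨ ⊛-congʳ (D w) (C-one-minus w allowed-v) ⟩
    C w ⊛ D w                ≈⟨ C⊛D w ⟩
    one                      ∎
    where
    open ≗-Reasoning
    F = one ⊖ qpow (suc w)

  cornerUnit : ℕ → Series
  cornerUnit zero    = 0ₛ
  cornerUnit (suc _) = one

  N : ℕ → Series
  N zero    = 0ₛ
  N (suc w) = if allowed (suc w) then N w ⊕ qpow (suc w) ⊛ (cornerUnit w ⊕ qpow (suc w)) else N w

  N-allowed : ∀ w → allowed (suc w) ≡ true → N (suc w) ≡ N w ⊕ qpow (suc w) ⊛ (cornerUnit w ⊕ qpow (suc w))
  N-allowed w = cong (λ b → if b then N w ⊕ qpow (suc w) ⊛ (cornerUnit w ⊕ qpow (suc w)) else N w)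

  N-forbidden : ∀ w → allowed (suc w) ≡ false → N (suc w) ≡ N w
  N-forbidden w = cong (λ b → if b then N w ⊕ qpow (suc w) ⊛ (cornerUnit w ⊕ qpow (suc w)) else N w)

  module _ (gap : ∀ w → allowed (suc (suc w)) ≡ true → allowed (suc w) ≡ false) where

    cornerGF≗ : ∀ w → allowed (suc w) ≡ true → cornerGF w ≗ cornerUnit w ⊛ C w
    cornerGF≗ zero    _         n = sym (⊛-zeroˡ (C 0) n)
    cornerGF≗ (suc w) allowed-v n =
      sym (trans (⊛-identityˡ (C (suc w)) n) (GF-step-forbidden (λ _ → 1) w (gap w allowed-v) n))

    H⊛D : ∀ m → H m ⊛ D m ≗ N m
    H⊛D zero n = trans (⊛-congʳ one H-zero n) (⊛-zeroˡ one n)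
    H⊛D (suc w) with allowed (suc w) in allowed-v
    ... | false = λ n → trans (⊛-congʳ (D w) (GF-step-forbidden hook2 w allowed-v) n) (H⊛D w n)
    ... | true  = begin
      H (suc w) ⊛ (D w ⊛ F)          ≈⟨ ⊛-congˡ (H (suc w)) (⊛-comm (D w) F) ⟩
      H (suc w) ⊛ (F ⊛ D w)          ≈⟨ ⊛-assoc (H (suc w)) F (D w) ⟨
      (H (suc w) ⊛ F) ⊛ D w          ≈⟨ ⊛-congʳ (D w) (⊛-one-minus (H (suc w)) (H w) R q H-step) ⟩
      (H w ⊕ q ⊛ R) ⊛ D w            ≈⟨ ⊛-distribʳ (D w) (H w) (q ⊛ R) ⟩
      H w ⊛ D w ⊕ (q ⊛ R) ⊛ D w      ≈⟨ ⊕-cong (H⊛D w) (⊛-assoc q R (D w)) ⟩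
      N w ⊕ q ⊛ (R ⊛ D w)            ≈⟨ ⊕-congˡ (N w) (⊛-congˡ q R⊛D) ⟩
      N w ⊕ q ⊛ (cornerUnit w ⊕ q)   ∎
      where
      open ≗-Reasoning
      q = qpow (suc w)
      F = one ⊖ q
      R = cornerGF w ⊕ q ⊛ C w
      H-step = H-step-allowed w allowed-v
      R⊛D : R ⊛ D w ≗ cornerUnit w ⊕ q
      R⊛D = begin
        (cornerGF w ⊕ q ⊛ C w) ⊛ D w             ≈⟨ ⊛-congʳ (D w) (⊕-congʳ (q ⊛ C w) (cornerGF≗ w allowed-v)) ⟩
        (cornerUnit w ⊛ C w ⊕ q ⊛ C w) ⊛ D w     ≈⟨ ⊛-congʳ (D w) (⊛-distribʳ (C w) (cornerUnit w) q) ⟨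
        ((cornerUnit w ⊕ q) ⊛ C w) ⊛ D w         ≈⟨ ⊛-assoc (cornerUnit w ⊕ q) (C w) (D w) ⟩
        (cornerUnit w ⊕ q) ⊛ (C w ⊛ D w)         ≈⟨ ⊛-congˡ (cornerUnit w ⊕ q) (C⊛D w) ⟩
        (cornerUnit w ⊕ q) ⊛ one                 ≈⟨ ⊛-identityʳ (cornerUnit w ⊕ q) ⟩
        cornerUnit w ⊕ q                         ∎

module Parity where
  open import Data.Bool using (true; false; not)
  open import Data.Bool.Properties using (not-involutive)
  open import Data.Nat using (zero; suc; _*_; _%_; _≡ᵇ_)
  open import Data.Nat.DivMod using (%-remove-+ˡ; m*n%n≡0; [m+kn]%n≡m%n)
  open import Data.Nat.Divisibility using (∣-refl)
  open import Data.Nat.Properties using (*-comm)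
  open import Relation.Binary.PropositionalEquality using (_≡_; refl; sym; trans; cong)

  isOdd-suc-suc : ∀ n → isOdd (suc (suc n)) ≡ isOdd n
  isOdd-suc-suc n = cong (_≡ᵇ 1) (%-remove-+ˡ n ∣-refl)

  isOdd-suc : ∀ n → isOdd (suc n) ≡ not (isOdd n)
  isOdd-suc zero    = refl
  isOdd-suc (suc n) = trans (isOdd-suc-suc n) (sym (trans (cong not (isOdd-suc n)) (not-involutive (isOdd n))))

  isOdd-even : ∀ k → isOdd (2 * k) ≡ false
  isOdd-even k = cong (_≡ᵇ 1) (trans (cong (_% 2) (*-comm 2 k)) (m*n%n≡0 k 2))

  isOdd-odd : ∀ k → isOdd (suc (2 * k)) ≡ true
  isOdd-odd k = cong (_≡ᵇ 1) (trans (cong (λ x → suc x % 2) (*-comm 2 k)) ([m+kn]%n≡m%n 1 k 2))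

module OddParts (k : ℕ) where
  open Series
  open Parity
  open import Data.Bool using (true; false; _∧_)
  open import Data.Bool.Properties using (∧-zeroʳ; T-≡)
  open import Data.Empty using (⊥-elim)
  open import Data.Integer as ℤ using (+_)
  import Data.Integer.Properties as ℤ
  import Data.Integer.Tactic.RingSolver as ℤ-Solver
  open import Data.Nat using (zero; suc; _+_; _*_; _∸_; _≤_; _<_; _≤ᵇ_; z≤n; s≤s)
  open import Data.Nat.Properties
    using (*-suc; ≤-trans; ≤-refl; n≤1+n; ≤⇒≤ᵇ; ≤ᵇ-reflects-≤; <⇒≱; m+n∸m≡n; m≤m+n; *-monoʳ-≤)
  open import Data.Nat.Tactic.RingSolver using (solve-∀)
  open import Function.Bundles using (Equivalence)
  open import Relation.Nullary.Reflects using (ofʸ)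
  open import Relation.Binary.PropositionalEquality
    using (_≡_; _≗_; refl; sym; trans; subst; cong; cong₂; module ≡-Reasoning)

  L M : ℕ
  L = suc k
  M = 2 * L ∸ 1

  oddUpToM : ℕ → Bool
  oddUpToM p = isOdd p ∧ (p ≤ᵇ M)

  open RestrictedPartitions oddUpToM public

  M≡ : M ≡ suc (2 * k)
  M≡ = cong (_∸ 1) (*-suc 2 k)

  gap : ∀ w → oddUpToM (suc (suc w)) ≡ true → oddUpToM (suc w) ≡ false
  gap w allowed with isOdd (suc (suc w)) | isOdd (suc w) | isOdd-suc (suc w)
  gap w ()      | false | _     | _
  gap w _       | true  | false | _  = refl
  gap w _       | true  | true  | ()

  odd-allowed : ∀ j → j ≤ k → oddUpToM (suc (2 * j)) ≡ true
  odd-allowed j j≤k = cong₂ _∧_ (isOdd-odd j) (Equivalence.to T-≡ (≤⇒≤ᵇ 2j<M))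
    where 2j<M = subst (suc (2 * j) ≤_) (sym M≡) (s≤s (*-monoʳ-≤ 2 j≤k))

  even-forbidden : ∀ j → oddUpToM (suc (suc (2 * j))) ≡ false
  even-forbidden j = cong (_∧ (suc (suc (2 * j)) ≤ᵇ M)) (trans (isOdd-suc-suc (2 * j)) (isOdd-even j))

  forbidden-above : ∀ {v} → M < v → oddUpToM v ≡ false
  forbidden-above {v} M<v with v ≤ᵇ M | ≤ᵇ-reflects-≤ v M
  ... | false | _       = ∧-zeroʳ (isOdd v)
  ... | true  | ofʸ v≤M = ⊥-elim (<⇒≱ M<v v≤M)

  D-odd : ∀ j → j ≤ k → D (suc (2 * j)) ≡ qPoch 1 2 (suc j)
  D-odd zero    _   = D-allowed 0 (odd-allowed 0 z≤n)
  D-odd (suc i) i<k = begin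
    D (suc (2 * suc i))          ≡⟨ D-allowed (2 * suc i) (odd-allowed (suc i) i<k) ⟩
    D (2 * suc i) ⊛ F            ≡⟨ cong (λ w → D w ⊛ F) (*-suc 2 i) ⟩
    D (suc (suc (2 * i))) ⊛ F    ≡⟨ cong (_⊛ F) (D-forbidden (suc (2 * i)) (even-forbidden i)) ⟩
    D (suc (2 * i)) ⊛ F          ≡⟨ cong (_⊛ F) (D-odd i (≤-trans (n≤1+n i) i<k)) ⟩
    qPoch 1 2 (suc i) ⊛ F        ∎
    where
    open ≡-Reasoning
    F = one ⊖ qpow (suc (2 * suc i))

  bracket : ℕ → Series
  bracket j = qpow 2 ⊕ qpow 3 ⊛ ((one ⊖ qpow (2 * j)) ⊛ inv (one ⊖ qpow 2))
                     ⊕ qpow 6 ⊛ ((one ⊖ qpow (4 * j)) ⊛ inv (one ⊖ qpow 4))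

  bracket-zero : bracket 0 ≗ qpow 2
  bracket-zero n = trans (cong₂ (λ a b → qpow 2 n ℤ.+ a ℤ.+ b) (vanishes 1 3 n) (vanishes 3 6 n))
                         (trans (ℤ.+-identityʳ _) (ℤ.+-identityʳ _))
    where
    vanishes : ∀ d a → qpow a ⊛ ((one ⊖ qpow 0) ⊛ inv (one ⊖ qpow (suc d))) ≗ 0ₛ
    vanishes d a = begin
      qpow a ⊛ ((one ⊖ qpow 0) ⊛ I)   ≈⟨ ⊛-congˡ (qpow a) (⊛-congʳ I one-⊖-qpow-zero) ⟩
      qpow a ⊛ (0ₛ ⊛ I)               ≈⟨ ⊛-congˡ (qpow a) (⊛-zeroˡ I) ⟩
      qpow a ⊛ 0ₛ                     ≈⟨ ⊛-zeroʳ (qpow a) ⟩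
      0ₛ                              ∎
      where
      open ≗-Reasoning
      I = inv (one ⊖ qpow (suc d))

  geometric-shift : ∀ c d j →
    qpow c ⊛ ((one ⊖ qpow (suc d * suc j)) ⊛ inv (one ⊖ qpow (suc d)))
      ≗ qpow c ⊛ ((one ⊖ qpow (suc d * j)) ⊛ inv (one ⊖ qpow (suc d))) ⊕ qpow (c + suc d * j)
  geometric-shift c d j = begin
    qpow c ⊛ ((one ⊖ qpow (suc d * suc j)) ⊛ I)     ≡⟨ cong (λ e → qpow c ⊛ ((one ⊖ qpow e) ⊛ I)) (exponent d j) ⟩
    qpow c ⊛ ((one ⊖ qpow (suc d * j + suc d)) ⊛ I) ≈⟨ ⊛-congˡ (qpow c) (geometric-step (suc d * j) d) ⟩
    qpow c ⊛ (A ⊕ qpow (suc d * j))                 ≈⟨ ⊛-distribˡ (qpow c) A (qpow (suc d * j)) ⟩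
    qpow c ⊛ A ⊕ qpow c ⊛ qpow (suc d * j)          ≈⟨ ⊕-congˡ (qpow c ⊛ A) (qpow-+ c (suc d * j)) ⟩
    qpow c ⊛ A ⊕ qpow (c + suc d * j)               ∎
    where
    open ≗-Reasoning
    I = inv (one ⊖ qpow (suc d))
    A = (one ⊖ qpow (suc d * j)) ⊛ I
    exponent : ∀ d j → suc d * suc j ≡ suc d * j + suc d
    exponent = solve-∀

  bracket-step : ∀ j → bracket (suc j) ≗ bracket j ⊕ (qpow (3 + 2 * j) ⊕ qpow (6 + 4 * j))
  bracket-step j n = trans
    (cong₂ (λ a b → qpow 2 n ℤ.+ a ℤ.+ b) (geometric-shift 3 1 j n) (geometric-shift 6 3 j n))
    (regroup (qpow 2 n) _ _ _ _)
    where
    regroup : ∀ a b c d e → a ℤ.+ (b ℤ.+ c) ℤ.+ (d ℤ.+ e) ≡ a ℤ.+ b ℤ.+ d ℤ.+ (c ℤ.+ e)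
    regroup = ℤ-Solver.solve-∀

  N-odd : ∀ j → j ≤ k → N (suc (2 * j)) ≗ bracket j
  N-odd zero _ = begin
    N 1                           ≡⟨ N-allowed 0 (odd-allowed 0 z≤n) ⟩
    0ₛ ⊕ qpow 1 ⊛ (0ₛ ⊕ qpow 1)   ≈⟨ ⊕-identityˡ (qpow 1 ⊛ (0ₛ ⊕ qpow 1)) ⟩
    qpow 1 ⊛ (0ₛ ⊕ qpow 1)        ≈⟨ ⊛-congˡ (qpow 1) (⊕-identityˡ (qpow 1)) ⟩
    qpow 1 ⊛ qpow 1               ≈⟨ qpow-+ 1 1 ⟩
    qpow 2                        ≈⟨ bracket-zero ⟨
    bracket 0                     ∎
    where open ≗-Reasoning
  N-odd (suc i) i<k = begin
    N (suc (2 * suc i))                                ≡⟨ N-allowed (2 * suc i) (odd-allowed (suc i) i<k) ⟩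
    N (2 * suc i) ⊕ new                                ≡⟨ cong (λ w → N w ⊕ new) (*-suc 2 i) ⟩
    N (suc (suc (2 * i))) ⊕ new                        ≡⟨ cong (_⊕ new) (N-forbidden (suc (2 * i)) (even-forbidden i)) ⟩
    N (suc (2 * i)) ⊕ new                              ≈⟨ ⊕-cong (N-odd i (≤-trans (n≤1+n i) i<k)) new≗ ⟩
    bracket i ⊕ (qpow (3 + 2 * i) ⊕ qpow (6 + 4 * i))  ≈⟨ bracket-step i ⟨
    bracket (suc i)                                    ∎
    where
    open ≗-Reasoning
    e = suc (2 * suc i)
    new = qpow e ⊛ (one ⊕ qpow e)
    exponent₁ : ∀ i → suc (2 * suc i) ≡ 3 + 2 * i
    exponent₁ = solve-∀
    exponent₂ : ∀ i → suc (2 * suc i) + suc (2 * suc i) ≡ 6 + 4 * i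
    exponent₂ = solve-∀
    new≗ : new ≗ qpow (3 + 2 * i) ⊕ qpow (6 + 4 * i)
    new≗ = begin
      qpow e ⊛ (one ⊕ qpow e)          ≈⟨ ⊛-distribˡ (qpow e) one (qpow e) ⟩
      qpow e ⊛ one ⊕ qpow e ⊛ qpow e   ≈⟨ ⊕-cong (⊛-identityʳ (qpow e)) (qpow-+ e e) ⟩
      qpow e ⊕ qpow (e + e)            ≈⟨ ⊕-cong (qpow-cong (exponent₁ i)) (qpow-cong (exponent₂ i)) ⟩
      qpow (3 + 2 * i) ⊕ qpow (6 + 4 * i) ∎

  rhsBracket : Series
  rhsBracket = qpow 2 ⊕ qpow 3 ⊛ ((one ⊖ qpow (2 * L ∸ 2)) ⊛ inv (one ⊖ qpow 2))
                      ⊕ qpow 6 ⊛ ((one ⊖ qpow (4 * L ∸ 4)) ⊛ inv (one ⊖ qpow 4))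

  rhsBracket≡bracket : rhsBracket ≡ bracket k
  rhsBracket≡bracket = cong₂ (λ a b → qpow 2 ⊕ qpow 3 ⊛ ((one ⊖ qpow a) ⊛ inv (one ⊖ qpow 2))
                                             ⊕ qpow 6 ⊛ ((one ⊖ qpow b) ⊛ inv (one ⊖ qpow 4)))
    (trans (cong (_∸ 2) (*-suc 2 k)) (m+n∸m≡n 2 (2 * k)))
    (trans (cong (_∸ 4) (*-suc 4 k)) (m+n∸m≡n 4 (4 * k)))

  A2≡H : ∀ n → A2 L n ≡ H M n
  A2≡H n = begin
    A2 L n          ≡⟨ GF-diagonal hook2 n ⟩
    H n n           ≡⟨ GF-bound hook2 (m≤m+n n M) ⟨
    H (n + M) n     ≡⟨ GF-above hook2 M forbidden-above n n ⟩
    H M n           ∎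
    where open ≡-Reasoning

  H⊛qPoch : H M ⊛ qPoch 1 2 L ≗ rhsBracket
  H⊛qPoch = begin
    H M ⊛ qPoch 1 2 L   ≡⟨ cong (λ d → H M ⊛ d) (trans (cong D M≡) (D-odd k ≤-refl)) ⟨
    H M ⊛ D M           ≈⟨ H⊛D gap M ⟩
    N M                 ≡⟨ cong N M≡ ⟩
    N (suc (2 * k))     ≈⟨ N-odd k ≤-refl ⟩
    bracket k           ≡⟨ rhsBracket≡bracket ⟨
    rhsBracket          ∎
    where open ≗-Reasoning

  qPoch-coeff-zero : ∀ j → qPoch 1 2 j 0 ≡ + 1
  qPoch-coeff-zero zero    = refl
  qPoch-coeff-zero (suc j) = trans (⊛-coeff-zero (qPoch 1 2 j) (one ⊖ qpow (1 + 2 * j)))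
                                   (cong (ℤ._* + 1) (qPoch-coeff-zero j))

theorem2p1 : (L : ℕ) → 1 Data.Nat.≤ L → (n : ℕ) → A2 L n ≡ RHS L n
theorem2p1 (suc k) _ n = begin
  A2 L n                                       ≡⟨ A2≡H n ⟩
  H M n                                        ≡⟨ ⊛-inverse-cancel (qPoch 1 2 L) (H M) (qPoch-coeff-zero L) n ⟨
  (inv (qPoch 1 2 L) ⊛ (H M ⊛ qPoch 1 2 L)) n  ≡⟨ ⊛-congˡ (inv (qPoch 1 2 L)) H⊛qPoch n ⟩
  RHS L n                                      ∎
  where
  open ≡-Reasoning
  open Series
  open OddParts k
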